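{- For every integer $k \geq 1$, the graph $G_k$ has a heavy Hamiltonian cycle, i.e. a Hamiltonian cycle $C$ with $A_k \subseteq E(C)$.
   Context: For an integer $k \geq 1$, $G_k := K_k \vee P_{2k+1}$ is the join of a complete graph on vertices $x_1, \ldots, x_k$ with a path on $2k+1$ vertices whose vertices, in order along the path, are $u_1, u_2, \ldots, u_k, z, v_k, v_{k-1}, \ldots, v_1$ (every $x_i$ is adjacent to every path vertex and to every other $x_j$). The set of heavy edges of $G_k$ is $A_k = \{x_iu_i : 1 \leq i \leq k\} \cup \{x_iv_i : 1 \leq i \leq k-1\}$. A cycle of $G_k$ is heavy if it contains every edge of $A_k$. -}

module Defs where

open import Data.Nat using (ℕ; zero; suc; _+_; _*_; _<_)
open import Data.Fin using (Fin; toℕ; inject₁; fromℕ) renaming (zero to fzero; suc to fsuc)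
open import Data.Product using (Σ; ∃; _×_; _,_)
open import Data.Sum using (_⊎_)
open import Relation.Binary.PropositionalEquality using (_≡_)
open import Function.Definitions using (Bijective)

-- Vertices of G_k = K_k ∨ P_{2k+1}.  Index i : Fin k stands for the paper's
-- index i+1 (so X i = x_{i+1}, U i = u_{i+1}, V i = v_{i+1}); Z = z.
data Vtx (k : ℕ) : Set where
  X : Fin k → Vtx k
  U : Fin k → Vtx k
  Z : Vtx k
  V : Fin k → Vtx k

-- One orientation of each edge of G_k.
data Edge₀ {k : ℕ} : Vtx k → Vtx k → Set where
  xx   : ∀ {i j} → toℕ i < toℕ j → Edge₀ (X i) (X j)
  xu   : ∀ {i j} → Edge₀ (X i) (U j)
  xz   : ∀ {i} → Edge₀ (X i) Z
  xv   : ∀ {i j} → Edge₀ (X i) (V j)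
  -- path u_1 u_2 … u_k z v_k … v_2 v_1
  uu   : ∀ {i j} → toℕ j ≡ suc (toℕ i) → Edge₀ (U i) (U j)
  uz   : ∀ {i} → suc (toℕ i) ≡ k → Edge₀ (U i) Z
  zv   : ∀ {i} → suc (toℕ i) ≡ k → Edge₀ Z (V i)
  vv   : ∀ {i j} → toℕ i ≡ suc (toℕ j) → Edge₀ (V i) (V j)

Adj : {k : ℕ} → Vtx k → Vtx k → Set
Adj a b = Edge₀ a b ⊎ Edge₀ b a

SamePair : {A : Set} → A → A → A → A → Set
SamePair a b c d = (a ≡ c × b ≡ d) ⊎ (a ≡ d × b ≡ c)

CycleEdge : {k n : ℕ} → (Fin (suc n) → Vtx k) → Vtx k → Vtx k → Set
CycleEdge {n = n} c a b =
  (∃ λ (i : Fin n) → SamePair (c (inject₁ i)) (c (fsuc i)) a b)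
  ⊎ SamePair (c (fromℕ n)) (c fzero) a b

-- G_k has 3k+1 ≥ 4 vertices, so such a sequence is a genuine cycle.
IsHamCycle : {k n : ℕ} → (Fin (suc n) → Vtx k) → Set
IsHamCycle {n = n} c =
  Bijective _≡_ _≡_ c
  × ((i : Fin n) → Adj (c (inject₁ i)) (c (fsuc i)))
  × Adj (c (fromℕ n)) (c fzero)

-- Heavy: contains all edges of A_k = {x_i u_i : 1 ≤ i ≤ k} ∪ {x_i v_i : 1 ≤ i ≤ k-1}.
IsHeavy : {k n : ℕ} → (Fin (suc n) → Vtx k) → Set
IsHeavy {k} c =
  ((i : Fin k) → CycleEdge c (X i) (U i))
  × ((i : Fin k) → suc (toℕ i) < k → CycleEdge c (X i) (V i))

module Submission where

open import Defs
open import Data.Nat using (ℕ; suc; _+_; _*_; _≥_; _<_; s≤s)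
open import Data.Nat.Properties using (*-comm)
open import Data.Fin using (Fin; toℕ; inject₁; fromℕ; raise) renaming (zero to fzero; suc to fsuc)
open import Data.Product using (Σ; ∃; _×_; _,_; proj₂)
open import Data.Sum using (inj₁; inj₂; swap)
open import Data.Bool using (Bool; true; false; not)
open import Function.Bundles using (mk↔ₛ′; Bijection)
open import Function.Properties.Inverse using (↔⇒⤖)
open import Relation.Binary.PropositionalEquality using (_≡_; refl; cong; subst; subst₂; sym; trans)

-- Deleting x₁, u₁, v₁ from G_{k+1} leaves a copy of G_k with all indices raised by one.
-- Hence a Hamiltonian path of G_k from w₁ (w one of the arms u, v) to some x_i, whose
-- interior edges include A_k, lifts to G_{k+1}: shift it and prepend w'₁ x₁ w₁, where w'
-- is the other arm.  Here w₁w₂ is a path edge and x₁w'₁, x₁w₁ are the new heavy edges.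
-- The new path starts on the other arm, and it closes to a cycle since x_i is adjacent
-- to every vertex.  The induction starts from v₁ z u₁ x₁ in G₁.

arm : ∀ {k} → Bool → Fin k → Vtx k
arm true  = U
arm false = V

shift : ∀ {k} → Vtx k → Vtx (suc k)
shift (X i) = X (fsuc i)
shift (U i) = U (fsuc i)
shift Z     = Z
shift (V i) = V (fsuc i)

shift-Edge₀ : ∀ {k} {a b : Vtx k} → Edge₀ a b → Edge₀ (shift a) (shift b)
shift-Edge₀ (xx i<j)   = xx (s≤s i<j)
shift-Edge₀ xu         = xu
shift-Edge₀ xz         = xz
shift-Edge₀ xv         = xv
shift-Edge₀ (uu j≡i+1) = uu (cong suc j≡i+1)
shift-Edge₀ (uz i+1≡k) = uz (cong suc i+1≡k)
shift-Edge₀ (zv i+1≡k) = zv (cong suc i+1≡k)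
shift-Edge₀ (vv i≡j+1) = vv (cong suc i≡j+1)

shift-Adj : ∀ {k} {a b : Vtx k} → Adj a b → Adj (shift a) (shift b)
shift-Adj (inj₁ e) = inj₁ (shift-Edge₀ e)
shift-Adj (inj₂ e) = inj₂ (shift-Edge₀ e)

shift-arm : ∀ {k} b (i : Fin k) → shift (arm b i) ≡ arm b (fsuc i)
shift-arm true  i = refl
shift-arm false i = refl

X-arm-Adj : ∀ {k} b (i j : Fin k) → Adj (X i) (arm b j)
X-arm-Adj true  i j = inj₁ xu
X-arm-Adj false i j = inj₁ xv

arm-Adj : ∀ {k} b → Adj {suc (suc k)} (arm b fzero) (arm b (fsuc fzero))
arm-Adj true  = inj₁ (uu refl)
arm-Adj false = inj₂ (vv refl)

PathEdge : ∀ {k m} → (Fin (suc m) → Vtx k) → Vtx k → Vtx k → Set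
PathEdge {m = m} p a b = ∃ λ (j : Fin m) → SamePair (p (inject₁ j)) (p (fsuc j)) a b

record HeavyHamPath (n : ℕ) (start : Bool) (m : ℕ) : Set where
  field
    path       : Fin (suc m) → Vtx (suc n)
    index      : Vtx (suc n) → Fin (suc m)
    path∘index : ∀ y → path (index y) ≡ y
    index∘path : ∀ i → index (path i) ≡ i
    steps      : (i : Fin m) → Adj (path (inject₁ i)) (path (fsuc i))
    starts     : path fzero ≡ arm start fzero
    ends       : ∃ λ i → path (fromℕ m) ≡ X i
    heavyU     : ∀ i → PathEdge path (X i) (U i)
    heavyV     : ∀ i → suc (toℕ i) < suc n → PathEdge path (X i) (V i)

base : HeavyHamPath 0 false 3
base = record
  { path       = path
  ; index      = index
  ; path∘index = λ { (X fzero) → refl ; (U fzero) → refl ; Z → refl ; (V fzero) → refl }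
  ; index∘path = λ { fzero → refl ; (fsuc fzero) → refl ; (fsuc (fsuc fzero)) → refl
                   ; (fsuc (fsuc (fsuc fzero))) → refl }
  ; steps      = λ { fzero → inj₂ (zv refl) ; (fsuc fzero) → inj₂ (uz refl)
                   ; (fsuc (fsuc fzero)) → inj₂ xu }
  ; starts     = refl
  ; ends       = fzero , refl
  ; heavyU     = λ { fzero → fsuc (fsuc fzero) , inj₂ (refl , refl) }
  ; heavyV     = λ { fzero (s≤s ()) }
  }
  where
  path : Fin 4 → Vtx 1
  path fzero                      = V fzero
  path (fsuc fzero)               = Z
  path (fsuc (fsuc fzero))        = U fzero
  path (fsuc (fsuc (fsuc fzero))) = X fzero

  index : Vtx 1 → Fin 4
  index (X fzero) = fsuc (fsuc (fsuc fzero))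
  index (U fzero) = fsuc (fsuc fzero)
  index Z         = fsuc fzero
  index (V fzero) = fzero

consPath : ∀ {k m} → Bool → (Fin (suc m) → Vtx k) → Fin (suc (3 + m)) → Vtx (suc k)
consPath b p fzero                  = arm (not b) fzero
consPath b p (fsuc fzero)           = X fzero
consPath b p (fsuc (fsuc fzero))    = arm b fzero
consPath b p (fsuc (fsuc (fsuc i))) = shift (p i)

armIndex : ∀ {l} → (start side : Bool) → Fin (3 + l)
armIndex true  true  = fsuc (fsuc fzero)
armIndex true  false = fzero
armIndex false true  = fzero
armIndex false false = fsuc (fsuc fzero)

consIndex : ∀ {k m} → Bool → (Vtx k → Fin (suc m)) → Vtx (suc k) → Fin (suc (3 + m))
consIndex b q (X fzero)    = fsuc fzero
consIndex b q (U fzero)    = armIndex b true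
consIndex b q (V fzero)    = armIndex b false
consIndex b q (X (fsuc i)) = raise 3 (q (X i))
consIndex b q (U (fsuc i)) = raise 3 (q (U i))
consIndex b q Z            = raise 3 (q Z)
consIndex b q (V (fsuc i)) = raise 3 (q (V i))

consIndex-shift : ∀ {k m} b (q : Vtx k → Fin (suc m)) y → consIndex b q (shift y) ≡ raise 3 (q y)
consIndex-shift b q (X i) = refl
consIndex-shift b q (U i) = refl
consIndex-shift b q Z     = refl
consIndex-shift b q (V i) = refl

consPath∘consIndex : ∀ {k m} b {p : Fin (suc m) → Vtx k} {q} → (∀ y → p (q y) ≡ y) →
                     ∀ y → consPath b p (consIndex b q y) ≡ y
consPath∘consIndex b     pq (X fzero)    = refl
consPath∘consIndex true  pq (U fzero)    = refl
consPath∘consIndex false pq (U fzero)    = refl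
consPath∘consIndex true  pq (V fzero)    = refl
consPath∘consIndex false pq (V fzero)    = refl
consPath∘consIndex b     pq (X (fsuc i)) = cong shift (pq (X i))
consPath∘consIndex b     pq (U (fsuc i)) = cong shift (pq (U i))
consPath∘consIndex b     pq Z            = cong shift (pq Z)
consPath∘consIndex b     pq (V (fsuc i)) = cong shift (pq (V i))

consIndex∘consPath : ∀ {k m} b {p : Fin (suc m) → Vtx k} {q} → (∀ i → q (p i) ≡ i) →
                     ∀ i → consIndex b q (consPath b p i) ≡ i
consIndex∘consPath true  qp fzero                  = refl
consIndex∘consPath false qp fzero                  = refl
consIndex∘consPath b     qp (fsuc fzero)           = refl
consIndex∘consPath true  qp (fsuc (fsuc fzero))    = refl
consIndex∘consPath false qp (fsuc (fsuc fzero))    = refl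
consIndex∘consPath b {p} {q} qp (fsuc (fsuc (fsuc i))) =
  trans (consIndex-shift b q (p i)) (cong (raise 3) (qp i))

consPath-steps : ∀ {k m} b {p : Fin (suc m) → Vtx (suc k)} → p fzero ≡ arm b fzero →
                 (∀ i → Adj (p (inject₁ i)) (p (fsuc i))) →
                 ∀ i → Adj (consPath b p (inject₁ i)) (consPath b p (fsuc i))
consPath-steps b starts steps fzero        = swap (X-arm-Adj (not b) fzero fzero)
consPath-steps b starts steps (fsuc fzero) = X-arm-Adj b fzero fzero
consPath-steps b starts steps (fsuc (fsuc fzero)) =
  subst (Adj (arm b fzero)) (sym (trans (cong shift starts) (shift-arm b fzero))) (arm-Adj b)
consPath-steps b starts steps (fsuc (fsuc (fsuc i))) = shift-Adj (steps i)

consPath-PathEdge : ∀ {k m} b {p : Fin (suc m) → Vtx k} {a c} →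
                    PathEdge p a c → PathEdge (consPath b p) (shift a) (shift c)
consPath-PathEdge b (j , inj₁ (p≡a , q≡c)) = raise 3 j , inj₁ (cong shift p≡a , cong shift q≡c)
consPath-PathEdge b (j , inj₂ (p≡c , q≡a)) = raise 3 j , inj₂ (cong shift p≡c , cong shift q≡a)

consPath-heavy : ∀ {k m} b {p : Fin (suc m) → Vtx k} side →
                 PathEdge (consPath b p) (X fzero) (arm side fzero)
consPath-heavy true  true  = fsuc fzero , inj₁ (refl , refl)
consPath-heavy true  false = fzero , inj₂ (refl , refl)
consPath-heavy false true  = fzero , inj₂ (refl , refl)
consPath-heavy false false = fsuc fzero , inj₁ (refl , refl)

extend : ∀ {n b m} → HeavyHamPath n b m → HeavyHamPath (suc n) (not b) (3 + m)
extend {b = b} P = record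
  { path       = consPath b path
  ; index      = consIndex b index
  ; path∘index = consPath∘consIndex b path∘index
  ; index∘path = consIndex∘consPath b index∘path
  ; steps      = consPath-steps b starts steps
  ; starts     = refl
  ; ends       = let (i , last≡X) = ends in fsuc i , cong shift last≡X
  ; heavyU     = λ { fzero → consPath-heavy b true ; (fsuc i) → consPath-PathEdge b (heavyU i) }
  ; heavyV     = λ { fzero _ → consPath-heavy b false
                   ; (fsuc i) (s≤s i<n) → consPath-PathEdge b (heavyV i i<n) }
  }
  where open HeavyHamPath P

heavyHamPath : ∀ n → ∃ λ b → HeavyHamPath n b (suc n * 3)
heavyHamPath 0       = false , base
heavyHamPath (suc n) = let (b , P) = heavyHamPath n in not b , extend P

heavyHamPath⇒heavyHamCycle : ∀ {n b m} (P : HeavyHamPath n b m) →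
        IsHamCycle (HeavyHamPath.path P) × IsHeavy (HeavyHamPath.path P)
heavyHamPath⇒heavyHamCycle {b = b} P =
  ( (Bijection.bijective (↔⇒⤖ (mk↔ₛ′ path index path∘index index∘path)) , steps , closing)
  , (λ i → inj₁ (heavyU i)) , (λ i i<k → inj₁ (heavyV i i<k)) )
  where
  open HeavyHamPath P
  closing : Adj (path (fromℕ _)) (path fzero)
  closing = let (i , last≡X) = ends in subst₂ Adj (sym last≡X) (sym starts) (X-arm-Adj b i fzero)

lemma2p3 : (k : ℕ) → k ≥ 1 →
    Σ (Fin (suc (3 * k)) → Vtx k) λ c → IsHamCycle c × IsHeavy c
lemma2p3 (suc n) _ =
  subst (λ m → Σ (Fin (suc m) → Vtx (suc n)) λ c → IsHamCycle c × IsHeavy c)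
        (*-comm (suc n) 3) (_ , heavyHamPath⇒heavyHamCycle (proj₂ (heavyHamPath n)))
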